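{- The map $f$ is a bijection from the set $\mathcal{C}$ of all coin fountains to the set $\mathcal{S}$ of all Stanley polyominoes with at least two columns such that, for every coin fountain $C$ with $n$ north-east diagonals, $f(C)$ has $n+1$ columns and \[ 2e(C)-o(C)=\mathrm{area}(f(C)). \]
   Context: Stanley polyominoes: cells are unit squares $[i,i+1]\times[j,j+1]$; a Stanley polyomino (up to translation) is a set of cells forming $k\ge1$ rows $0,\dots,k-1$ (bottom to top), row $j$ consisting of the cells with $s_j\le i\le e_j$, such that $s_{j-1}<s_j\le e_{j-1}<e_j$ for $1\le j\le k-1$; its number of columns is $e_{k-1}-s_0+1$ and $\mathrm{area}$ is its number of cells. Coin fountains: a coin fountain with $d\geq1$ diagonals is a finite set $C\subset\mathbb{Z}\times\mathbb{Z}_{\ge0}$ (positions of coins) whose row $0$ is $\{(2i,0):0\le i\le d-1\}$ and such that every $(a,j)\in C$ with $j\geq1$ has $(a-1,j-1),(a+1,j-1)\in C$. The $i$-th north-east diagonal consists of the coins $(2i+j,j)\in C$; $\mathrm{diag}(C)$ is the number of coins on the first diagonal $i=0$. If $d\ge2$, $C'=\{(a-2,j):(a,j)\in C,\ a-j\ge2\}$ is the coin fountain obtained by deleting the first diagonal. Rows are numbered $0,1,2,\dots$ from the bottom; $e(C)$ (resp. $o(C)$) is the number of coins in even-numbered (resp. odd-numbered) rows. The map $f$: if $C$ is a single coin, $f(C)$ is the single row of two cells. If $d\ge2$, let $k=\mathrm{diag}(C)$ and $P'=f(C')$ with rows given by $s_j,e_j$. If $k=2\ell+1$ ($\ell\ge0$),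 $f(C)$ is obtained by adding below $P'$ a new bottom row of $\ell+2$ cells occupying $s_0-1\le i\le s_0+\ell$ (old rows move up by one). If $k=2\ell$ ($\ell\ge1$), $f(C)$ is obtained from $P'$ by adding one cell at the left end of each of its $\ell$ lowest rows (replacing $s_j$ by $s_j-1$ for $0\le j\le\ell-1$). This construction is always well defined and produces a Stanley polyomino. -}

module Defs where

open import Data.Nat as ℕ using (ℕ; zero; suc; _<_; _≤_; ⌊_/2⌋)
open import Data.Nat.DivMod using (_%_)
open import Data.Integer as ℤ using (ℤ; +_; _-_; _+_; 1ℤ; 0ℤ)
open import Data.Product using (_×_; _,_; ∃-syntax; proj₁; proj₂)
open import Data.List using (List; []; _∷_; length; filter; map; sum; foldr)
open import Data.List.Membership.Propositional using (_∈_)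
open import Data.List.Relation.Unary.Unique.Propositional using (Unique)
open import Data.List.Relation.Binary.Pointwise using (Pointwise)
open import Data.Empty using (⊥)
open import Function.Bundles using (_⇔_)
open import Relation.Binary.PropositionalEquality using (_≡_)

-- Coin fountains: a finite set of coins C ⊂ ℤ × ℤ≥0, given by a
-- duplicate-free list of positions (a , j).

Coin : Set
Coin = ℤ × ℕ

record CoinFountain : Set where
  field
    d       : ℕ                       -- number of diagonals
    d≥1     : 1 ≤ d
    coins   : List Coin
    unique  : Unique coins
    row0    : ∀ (a : ℤ) → ((a , 0) ∈ coins) ⇔ (∃[ i ] (i < d × a ≡ + (2 ℕ.* i)))
    support : ∀ (a : ℤ) (j : ℕ) → (a , suc j) ∈ coins →
              ((a - 1ℤ , j) ∈ coins) × ((a + 1ℤ , j) ∈ coins)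
open CoinFountain public

SameCoins : CoinFountain → CoinFountain → Set
SameCoins C₁ C₂ = ∀ (x : Coin) → (x ∈ coins C₁) ⇔ (x ∈ coins C₂)

eC : CoinFountain → ℕ
eC C = length (filter (λ x → proj₂ x % 2 ℕ.≟ 0) (coins C))

oC : CoinFountain → ℕ
oC C = length (filter (λ x → proj₂ x % 2 ℕ.≟ 1) (coins C))

diagL : List Coin → ℕ
diagL cs = length (filter (λ x → proj₁ x ℤ.≟ + proj₂ x) cs)

deleteFirstDiag : List Coin → List Coin
deleteFirstDiag cs =
  map (λ x → (proj₁ x - + 2 , proj₂ x))
      (filter (λ x → + 2 ℤ.≤? proj₁ x - + proj₂ x) cs)

-- Stanley polyominoes, given by their rows (s_j , e_j), bottom to top.
-- Row j consists of the cells [i,i+1]×[j,j+1] with s_j ≤ i ≤ e_j.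

Rows : Set
Rows = List (ℤ × ℤ)

IsStanley : Rows → Set
IsStanley [] = ⊥
IsStanley ((s , e) ∷ []) = s ℤ.≤ e
IsStanley ((s , e) ∷ (s' , e') ∷ rs) =
  (s ℤ.< s') × (s' ℤ.≤ e) × (e ℤ.< e') × IsStanley ((s' , e') ∷ rs)

-- equality up to translation (horizontal shift; rows are fixed vertically)
_≈T_ : Rows → Rows → Set
P ≈T Q = ∃[ t ] Pointwise (λ r r' → (proj₁ r' ≡ proj₁ r + t) × (proj₂ r' ≡ proj₂ r + t)) P Q

private
  lastE : ℤ → Rows → ℤ
  lastE e [] = e
  lastE _ ((_ , e) ∷ rs) = lastE e rs

columns : Rows → ℤ
columns [] = 0ℤ
columns ((s , e) ∷ rs) = lastE e rs - s + 1ℤ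

area : Rows → ℤ
area = foldr (λ r acc → (proj₂ r - proj₁ r + 1ℤ) + acc) 0ℤ

firstS : Rows → ℤ
firstS [] = 0ℤ                      -- never used on well-formed input
firstS ((s , _) ∷ _) = s

extendLeft : ℕ → Rows → Rows
extendLeft zero rs = rs
extendLeft (suc ℓ) [] = []
extendLeft (suc ℓ) ((s , e) ∷ rs) = (s - 1ℤ , e) ∷ extendLeft ℓ rs

fStep : ℕ → Rows → Rows
fStep k P' with k % 2
... | 1 = (firstS P' - 1ℤ , firstS P' + + ⌊ k /2⌋) ∷ P'
... | _ = extendLeft ⌊ k /2⌋ P'

fRaw : ℕ → List Coin → Rows
fRaw zero _ = []                                     -- d ≥ 1 always
fRaw (suc zero) _ = (0ℤ , 1ℤ) ∷ []                   -- single coin: row of two cells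
fRaw (suc (suc n)) cs = fStep (diagL cs) (fRaw (suc n) (deleteFirstDiag cs))

f : CoinFountain → Rows
f C = fRaw (d C) (coins C)

{-# OPTIONS --safe #-}
module Submission where

-- A coin fountain is determined by its profile, the heights k₀, …, k_{d-1} of its north-east
-- diagonals, which are exactly the sequences with kᵢ ≥ 1, kᵢ ≤ kᵢ₊₁ + 1 and k_{d-1} = 1.  f builds
-- a polyomino from the profile one diagonal at a time, and the height k of the diagonal added last
-- can be read off the result: for k = 2ℓ + 1 the bottom row has ℓ + 2 cells, for k = 2ℓ exactly ℓ
-- bottom rows form a left staircase (left ends s₀, s₀ + 1, …).  So f is injective up to
-- translation, and peeling off the last step (according to whether the bottom row is at most one
-- cell longer than the staircase) shows that every Stanley polyomino with at least three columns
-- comes from one with one column fewer, so f is onto.  Each step adds a column, and a diagonal of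
-- height k adds as many cells as its coins weigh when a coin in an even row weighs 2 and one in an
-- odd row weighs -1.

open import Defs

module Polyominoes where

  open import Algebra.Bundles using (AbelianGroup)
  import Algebra.Properties.Group as GroupProperties
  open import Data.Bool.Base using (if_then_else_)
  open import Data.Integer.Base as ℤ using (ℤ; +_; _+_; _-_; _≤_; _<_; 0ℤ; 1ℤ; +≤+; +<+)
  import Data.Integer.Properties as ℤ
  open import Data.Integer.Tactic.RingSolver using (solve)
  open import Data.List.Base using (List; []; _∷_; map; length; foldr)
  import Data.List.Properties as List
  open import Data.List.Relation.Binary.Pointwise as Pointwise using (Pointwise)
  open import Data.Nat.Base as ℕ using (ℕ; zero; suc; z≤n; s≤s; s≤s⁻¹)
  open import Data.Nat.DivMod using (_%_)
  import Data.Nat.Properties as ℕ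
  open import Data.Product.Base using (_×_; _,_; proj₁; proj₂; ∃-syntax)
  open import Function.Bundles using (_⇔_; mk⇔; Equivalence)
  open import Relation.Nullary using (does; yes; no; contradiction)
  open import Relation.Binary.PropositionalEquality

  variable
    k k′ ℓ m n : ℕ
    s s′ e e′ t : ℤ
    rs P Q : Rows

  half-≤ : ℓ ℕ.+ ℓ ℕ.≤ suc (m ℕ.+ m) → ℓ ℕ.≤ m
  half-≤ {zero} _ = z≤n
  half-≤ {suc ℓ} {zero} h rewrite ℕ.+-suc ℓ ℓ with () ← s≤s⁻¹ h
  half-≤ {suc ℓ} {suc m} h rewrite ℕ.+-suc ℓ ℓ | ℕ.+-suc m m = s≤s (half-≤ (s≤s⁻¹ (s≤s⁻¹ h)))

  double-≤ : ℓ ℕ.+ ℓ ℕ.≤ m ℕ.+ m → ℓ ℕ.≤ m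
  double-≤ h = half-≤ (ℕ.m≤n⇒m≤1+n h)

  double-mono : ℓ ℕ.≤ m → ℓ ℕ.+ ℓ ℕ.≤ m ℕ.+ m
  double-mono h = ℕ.+-mono-≤ h h

  suc-double : ∀ m → suc m ℕ.+ suc m ≡ suc (suc (m ℕ.+ m))
  suc-double m = cong suc (ℕ.+-suc m m)

  +-cancelʳ-≡ : ∀ t {i j} → i + t ≡ j + t → i ≡ j
  +-cancelʳ-≡ t = GroupProperties.∙-cancelʳ (AbelianGroup.group ℤ.+-0-abelianGroup) t _ _

  +-cancelˡ-≡ : ∀ t {i j} → t + i ≡ t + j → i ≡ j
  +-cancelˡ-≡ t = GroupProperties.∙-cancelˡ (AbelianGroup.group ℤ.+-0-abelianGroup) t _ _

  1+-cancel-≤ : ∀ {i j} → 1ℤ + i ≤ 1ℤ + j → i ≤ j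
  1+-cancel-≤ {i} {j} h = begin
    i                   ≡⟨ solve (i ∷ []) ⟩
    ℤ.-1ℤ + (1ℤ + i)    ≤⟨ ℤ.+-monoʳ-≤ ℤ.-1ℤ h ⟩
    ℤ.-1ℤ + (1ℤ + j)    ≡⟨ solve (j ∷ []) ⟩
    j                   ∎
    where open ℤ.≤-Reasoning

  ≤⇒offset : ∀ {i j} → i ≤ j → ∃[ n ] j ≡ i + + n
  ≤⇒offset {i} {j} i≤j = ℤ.∣ j - i ∣ , (begin
    j                ≡⟨ solve (i ∷ j ∷ []) ⟩
    i + (j - i)      ≡⟨ cong (λ x → i + x) (ℤ.0≤i⇒+∣i∣≡i (ℤ.i≤j⇒0≤j-i i≤j)) ⟨
    i + + ℤ.∣ j - i ∣ ∎)
    where open ≡-Reasoning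

  i-1<i : ∀ i → i - 1ℤ < i
  i-1<i i = subst (i - 1ℤ <_) (ℤ.+-identityʳ i) (ℤ.+-monoʳ-< i {ℤ.-1ℤ} {0ℤ} ℤ.-<+)

  i-1+1≡i : ∀ i → i - 1ℤ + 1ℤ ≡ i
  i-1+1≡i i = solve (i ∷ [])

  i+1-1≡i : ∀ i → i + 1ℤ - 1ℤ ≡ i
  i+1-1≡i i = solve (i ∷ [])

  i<i+1 : ∀ i → i < i + 1ℤ
  i<i+1 i = subst (_< i + 1ℤ) (ℤ.+-identityʳ i) (ℤ.+-monoʳ-< i {0ℤ} {1ℤ} (+<+ (s≤s z≤n)))

  i<j⇒i+1≤j : ∀ {i j} → i < j → i + 1ℤ ≤ j
  i<j⇒i+1≤j {i} i<j = subst (_≤ _) (ℤ.+-comm 1ℤ i) (ℤ.i<j⇒suc[i]≤j i<j)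

  width-mono : ∀ s {e e′} → e < e′ → e - s + 1ℤ ≤ e′ - (s + 1ℤ) + 1ℤ
  width-mono s {e} {e′} e<e′ = begin
    e - s + 1ℤ               ≡⟨ solve (e ∷ s ∷ []) ⟩
    1ℤ + e - s               ≤⟨ ℤ.+-monoˡ-≤ (ℤ.- s) (ℤ.i<j⇒suc[i]≤j e<e′) ⟩
    e′ - s                   ≡⟨ solve (e′ ∷ s ∷ []) ⟩
    e′ - (s + 1ℤ) + 1ℤ       ∎
    where open ℤ.≤-Reasoning

  i<j⇒i-1<j-1 : ∀ {i j} → i < j → i - 1ℤ < j - 1ℤ
  i<j⇒i-1<j-1 = ℤ.+-monoˡ-< ℤ.-1ℤ

  <⇔width≥ : ∀ s e x → s + x < e ⇔ + 2 + x ≤ e - s + 1ℤ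
  <⇔width≥ s e x = mk⇔
    (λ s+x<e → begin
      + 2 + x                ≡⟨ solve (s ∷ x ∷ []) ⟩
      1ℤ + (s + x) - s + 1ℤ  ≤⟨ ℤ.+-monoˡ-≤ 1ℤ (ℤ.+-monoˡ-≤ (ℤ.- s) (ℤ.i<j⇒suc[i]≤j s+x<e)) ⟩
      e - s + 1ℤ             ∎)
    (λ wide → ℤ.suc[i]≤j⇒i<j (begin
      1ℤ + (s + x)           ≡⟨ solve (s ∷ x ∷ []) ⟩
      + 2 + x + (s - 1ℤ)     ≤⟨ ℤ.+-monoˡ-≤ (s - 1ℤ) wide ⟩
      e - s + 1ℤ + (s - 1ℤ)  ≡⟨ solve (e ∷ s ∷ []) ⟩
      e                      ∎))
    where open ℤ.≤-Reasoning

  baseWidth : Rows → ℤ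
  baseWidth [] = 0ℤ
  baseWidth ((s , e) ∷ _) = e - s + 1ℤ

  stairFrom : ℤ → Rows → ℕ
  stairFrom s [] = 0
  stairFrom s ((s′ , _) ∷ rs) = if does (s′ ℤ.≟ s + 1ℤ) then suc (stairFrom s′ rs) else 0

  leftStair : Rows → ℕ
  leftStair [] = 0
  leftStair ((s , _) ∷ rs) = suc (stairFrom s rs)

  stairFrom-step : ∀ s r rs → proj₁ r ≡ s + 1ℤ → stairFrom s (r ∷ rs) ≡ leftStair (r ∷ rs)
  stairFrom-step s r rs eq with proj₁ r ℤ.≟ s + 1ℤ
  ... | yes _ = refl
  ... | no ne = contradiction eq ne

  stairFrom-break : ∀ s r rs → proj₁ r ≢ s + 1ℤ → stairFrom s (r ∷ rs) ≡ 0
  stairFrom-break s r rs ne with proj₁ r ℤ.≟ s + 1ℤ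
  ... | yes eq = contradiction eq ne
  ... | no _ = refl

  leftStair≤length : ∀ P → leftStair P ℕ.≤ length P
  leftStair≤length [] = z≤n
  leftStair≤length ((s , _) ∷ rs) = s≤s (go s rs)
    where
    go : ∀ s rs → stairFrom s rs ℕ.≤ length rs
    go s [] = z≤n
    go s ((s′ , _) ∷ rs) with s′ ℤ.≟ s + 1ℤ
    ... | yes _ = s≤s (go s′ rs)
    ... | no _ = z≤n

  -- The same as the private helper of columns in Defs.
  lastEnd : ℤ → Rows → ℤ
  lastEnd e [] = e
  lastEnd _ ((_ , e) ∷ rs) = lastEnd e rs

  columns-lastEnd : ∀ s e rs → columns ((s , e) ∷ rs) ≡ lastEnd e rs - s + 1ℤ
  columns-lastEnd s e [] = refl
  columns-lastEnd s e ((_ , e′) ∷ rs) = columns-lastEnd s e′ rs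

  lastEnd-stanley : IsStanley ((s , e) ∷ (s′ , e′) ∷ rs) → e < lastEnd e′ rs
  lastEnd-stanley {rs = []} (_ , _ , e<e′ , _) = e<e′
  lastEnd-stanley {rs = _ ∷ _} (_ , _ , e<e′ , st) = ℤ.<-trans e<e′ (lastEnd-stanley st)

  translate : ℤ → Rows → Rows
  translate t = map (λ (s , e) → (s + t , e + t))

  ShiftedBy : ℤ → (ℤ × ℤ) → (ℤ × ℤ) → Set
  ShiftedBy t r r′ = (proj₁ r′ ≡ proj₁ r + t) × (proj₂ r′ ≡ proj₂ r + t)

  ≈T⇒translate : P ≈T Q → ∃[ t ] translate t P ≡ Q
  ≈T⇒translate (t , pw) = t , go pw
    where
    go : Pointwise (ShiftedBy t) P Q → translate t P ≡ Q
    go Pointwise.[] = refl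
    go {(s , e) ∷ _} {(_ , _) ∷ _} ((refl , refl) Pointwise.∷ pw) = cong (_ ∷_) (go pw)

  translate⇒≈T : translate t P ≡ Q → P ≈T Q
  translate⇒≈T {t} {P} refl = t , go P
    where
    go : ∀ P → Pointwise (ShiftedBy t) P (translate t P)
    go [] = Pointwise.[]
    go (_ ∷ P) = (refl , refl) Pointwise.∷ go P

  translate-identity : ∀ P → translate 0ℤ P ≡ P
  translate-identity [] = refl
  translate-identity ((s , e) ∷ P) =
    cong₂ _∷_ (cong₂ _,_ (ℤ.+-identityʳ s) (ℤ.+-identityʳ e)) (translate-identity P)

  baseWidth-translate : ∀ t P → baseWidth (translate t P) ≡ baseWidth P
  baseWidth-translate t [] = refl
  baseWidth-translate t ((s , e) ∷ _) = cancel
    where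
    cancel : e + t - (s + t) + 1ℤ ≡ e - s + 1ℤ
    cancel = solve (e ∷ s ∷ t ∷ [])

  stairFrom-translate : ∀ t s rs → stairFrom (s + t) (translate t rs) ≡ stairFrom s rs
  stairFrom-translate t s [] = refl
  stairFrom-translate t s ((s′ , _) ∷ rs) with s′ ℤ.≟ s + 1ℤ | s′ + t ℤ.≟ s + t + 1ℤ
  ... | yes _ | yes _ = cong suc (stairFrom-translate t s′ rs)
  ... | no _ | no _ = refl
  ... | yes eq | no ne = contradiction (trans (cong (_+ t) eq) shift) ne
    where
    shift : s + 1ℤ + t ≡ s + t + 1ℤ
    shift = solve (s ∷ t ∷ [])
  ... | no ne | yes eq = contradiction (+-cancelʳ-≡ t (trans eq shift)) ne
    where
    shift : s + t + 1ℤ ≡ s + 1ℤ + t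
    shift = solve (s ∷ t ∷ [])

  leftStair-translate : ∀ t P → leftStair (translate t P) ≡ leftStair P
  leftStair-translate t [] = refl
  leftStair-translate t ((s , _) ∷ rs) = cong suc (stairFrom-translate t s rs)

  lastEnd-translate : ∀ t e rs → lastEnd (e + t) (translate t rs) ≡ lastEnd e rs + t
  lastEnd-translate t e [] = refl
  lastEnd-translate t _ ((_ , e) ∷ rs) = lastEnd-translate t e rs

  columns-translate : ∀ t P → columns (translate t P) ≡ columns P
  columns-translate t [] = refl
  columns-translate t ((s , e) ∷ rs) = begin
    columns ((s + t , e + t) ∷ translate t rs)
      ≡⟨ columns-lastEnd (s + t) (e + t) (translate t rs) ⟩
    lastEnd (e + t) (translate t rs) - (s + t) + 1ℤ
      ≡⟨ cong (λ x → x - (s + t) + 1ℤ) (lastEnd-translate t e rs) ⟩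
    lastEnd e rs + t - (s + t) + 1ℤ
      ≡⟨ cancel (lastEnd e rs) ⟩
    lastEnd e rs - s + 1ℤ
      ≡⟨ columns-lastEnd s e rs ⟨
    columns ((s , e) ∷ rs)
      ∎
    where
    open ≡-Reasoning
    cancel : ∀ x → x + t - (s + t) + 1ℤ ≡ x - s + 1ℤ
    cancel x = solve (x ∷ s ∷ t ∷ [])

  addBaseRow : ℕ → Rows → Rows
  addBaseRow ℓ P = (firstS P - 1ℤ , firstS P + + ℓ) ∷ P

  data Parity : ℕ → Set where
    odd  : ∀ ℓ → Parity (suc (ℓ ℕ.+ ℓ))
    even : ∀ ℓ → Parity (ℓ ℕ.+ ℓ)

  parity : ∀ k → Parity k
  parity zero = even 0
  parity (suc k) with parity k
  ... | odd ℓ = subst Parity (suc-double ℓ) (even (suc ℓ))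
  ... | even ℓ = odd ℓ

  double%2≡0 : ∀ ℓ → (ℓ ℕ.+ ℓ) % 2 ≡ 0
  double%2≡0 zero = refl
  double%2≡0 (suc ℓ) rewrite ℕ.+-suc ℓ ℓ = double%2≡0 ℓ

  1+double%2≡1 : ∀ ℓ → suc (ℓ ℕ.+ ℓ) % 2 ≡ 1
  1+double%2≡1 zero = refl
  1+double%2≡1 (suc ℓ) rewrite ℕ.+-suc ℓ ℓ = 1+double%2≡1 ℓ

  fStep-odd : ∀ ℓ P → fStep (suc (ℓ ℕ.+ ℓ)) P ≡ addBaseRow ℓ P
  fStep-odd ℓ P with suc (ℓ ℕ.+ ℓ) % 2 | 1+double%2≡1 ℓ
  ... | .1 | refl = cong (λ h → (firstS P - 1ℤ , firstS P + + h) ∷ P) (sym (ℕ.n≡⌈n+n/2⌉ ℓ))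

  fStep-even : ∀ ℓ P → fStep (ℓ ℕ.+ ℓ) P ≡ extendLeft ℓ P
  fStep-even ℓ P with (ℓ ℕ.+ ℓ) % 2 | double%2≡0 ℓ
  ... | .0 | refl = cong (λ h → extendLeft h P) (sym (ℕ.n≡⌊n+n/2⌋ ℓ))

  shiftRight : ℕ → Rows → Rows
  shiftRight zero rs = rs
  shiftRight (suc ℓ) [] = []
  shiftRight (suc ℓ) ((s , e) ∷ rs) = (s + 1ℤ , e) ∷ shiftRight ℓ rs

  extendLeft-shiftRight : ∀ ℓ P → extendLeft ℓ (shiftRight ℓ P) ≡ P
  extendLeft-shiftRight zero P = refl
  extendLeft-shiftRight (suc ℓ) [] = refl
  extendLeft-shiftRight (suc ℓ) ((s , e) ∷ rs) =
    cong₂ _∷_ (cong (_, e) (i+1-1≡i s)) (extendLeft-shiftRight ℓ rs)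

  extendLeft-injective : ∀ ℓ {P Q} → extendLeft ℓ P ≡ extendLeft ℓ Q → P ≡ Q
  extendLeft-injective zero eq = eq
  extendLeft-injective (suc ℓ) {[]} {[]} eq = refl
  extendLeft-injective (suc ℓ) {(s , e) ∷ P} {(s′ , e′) ∷ Q} eq =
    cong₂ _∷_ (cong₂ _,_ (+-cancelʳ-≡ ℤ.-1ℤ (cong proj₁ heads)) (cong proj₂ heads))
              (extendLeft-injective ℓ (List.∷-injectiveʳ eq))
    where
    heads = List.∷-injectiveˡ eq

  translate-extendLeft : ∀ t ℓ P → translate t (extendLeft ℓ P) ≡ extendLeft ℓ (translate t P)
  translate-extendLeft t zero P = refl
  translate-extendLeft t (suc ℓ) [] = refl
  translate-extendLeft t (suc ℓ) ((s , e) ∷ rs) =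
    cong₂ _∷_ (cong (_, e + t) swap) (translate-extendLeft t ℓ rs)
    where
    swap : s - 1ℤ + t ≡ s + t - 1ℤ
    swap = solve (s ∷ t ∷ [])

  translate-addBaseRow : ∀ t ℓ → IsStanley P →
                         translate t (addBaseRow ℓ P) ≡ addBaseRow ℓ (translate t P)
  translate-addBaseRow {(s , e) ∷ rs} t ℓ _ =
    cong (_∷ translate t ((s , e) ∷ rs)) (cong₂ _,_ (swap ℤ.-1ℤ) (swap (+ ℓ)))
    where
    swap : ∀ x → s + x + t ≡ s + t + x
    swap x = solve (s ∷ x ∷ t ∷ [])

  -- Reading the height of the first diagonal off f C

  data Encodes : ℕ → Rows → Set where
    odd  : baseWidth P ≡ + (2 ℕ.+ ℓ) → suc ℓ ℕ.≤ leftStair P → Encodes (suc (ℓ ℕ.+ ℓ)) P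
    even : leftStair P ≡ ℓ → + (2 ℕ.+ ℓ) ≤ baseWidth P → Encodes (ℓ ℕ.+ ℓ) P

  encodes-unique : Encodes k P → Encodes k′ P → k ≡ k′
  encodes-unique (odd w _) (odd w′ _) =
    cong (λ j → suc (j ℕ.+ j)) (ℕ.+-cancelˡ-≡ 2 _ _ (ℤ.+-injective (trans (sym w) w′)))
  encodes-unique (even r _) (even r′ _) = cong (λ j → j ℕ.+ j) (trans (sym r) r′)
  encodes-unique (odd w r) (even r′ w′) =
    contradiction (odd-stair>even-stair w r r′ w′) (ℕ.<-irrefl refl)
    where
    odd-stair>even-stair : ∀ {ℓ j} → baseWidth P ≡ + (2 ℕ.+ ℓ) → suc ℓ ℕ.≤ leftStair P →
                           leftStair P ≡ j → + (2 ℕ.+ j) ≤ baseWidth P → j ℕ.< j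
    odd-stair>even-stair w r r′ w′ =
      ℕ.≤-trans (s≤s (s≤s⁻¹ (s≤s⁻¹ (ℤ.drop‿+≤+ (subst (_ ≤_) w w′)))))
                (subst (_ ℕ.≤_) r′ r)
  encodes-unique (even r w) (odd w′ r′) = sym (encodes-unique (odd w′ r′) (even r w))

  encodes-translate : ∀ t → Encodes k P → Encodes k (translate t P)
  encodes-translate {P = P} t (odd w r) =
    odd (trans (baseWidth-translate t P) w) (subst (_ ℕ.≤_) (sym (leftStair-translate t P)) r)
  encodes-translate {P = P} t (even r w) =
    even (trans (leftStair-translate t P) r) (subst (_ ≤_) (sym (baseWidth-translate t P)) w)

  -- The profile condition on a new first diagonal, read off the polyomino it is added to.
  addBaseRow-fits : Encodes k P →
                    suc (ℓ ℕ.+ ℓ) ℕ.≤ suc k ⇔ (ℓ ℕ.≤ leftStair P × + (2 ℕ.+ ℓ) ≤ baseWidth P)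
  addBaseRow-fits (odd {ℓ = j} w r) = mk⇔
    (λ h → let ℓ≤j = half-≤ (s≤s⁻¹ h) in
      ℕ.≤-trans (ℕ.m≤n⇒m≤1+n ℓ≤j) r , subst (_ ≤_) (sym w) (+≤+ (s≤s (s≤s ℓ≤j))))
    (λ (_ , wide) →
      s≤s (ℕ.m≤n⇒m≤1+n (double-mono (s≤s⁻¹ (s≤s⁻¹ (ℤ.drop‿+≤+ (subst (_ ≤_) w wide)))))))
  addBaseRow-fits (even {ℓ = j} r w) = mk⇔
    (λ h → let ℓ≤j = double-≤ (s≤s⁻¹ h) in
      subst (_ ℕ.≤_) (sym r) ℓ≤j , ℤ.≤-trans (+≤+ (s≤s (s≤s ℓ≤j))) w)
    (λ (ℓ≤stair , _) → s≤s (double-mono (subst (_ ℕ.≤_) r ℓ≤stair)))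

  extendLeft-fits : Encodes k P →
                    ℓ ℕ.+ ℓ ℕ.≤ suc k ⇔ (ℓ ℕ.≤ leftStair P × + (1 ℕ.+ ℓ) ≤ baseWidth P)
  extendLeft-fits {ℓ = ℓ} (odd {ℓ = j} w r) = mk⇔
    (λ h → let ℓ≤1+j = double-≤ (subst (ℓ ℕ.+ ℓ ℕ.≤_) (sym (suc-double j)) h) in
      ℕ.≤-trans ℓ≤1+j r , subst (_ ≤_) (sym w) (+≤+ (s≤s ℓ≤1+j)))
    (λ (_ , wide) →
      subst (ℓ ℕ.+ ℓ ℕ.≤_) (suc-double j) (double-mono (s≤s⁻¹ (ℤ.drop‿+≤+ (subst (_ ≤_) w wide)))))
  extendLeft-fits (even {ℓ = j} r w) = mk⇔
    (λ h → let ℓ≤j = half-≤ h in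
      subst (_ ℕ.≤_) (sym r) ℓ≤j , ℤ.≤-trans (+≤+ (s≤s (ℕ.m≤n⇒m≤1+n ℓ≤j))) w)
    (λ (ℓ≤stair , _) → ℕ.m≤n⇒m≤1+n (double-mono (subst (_ ℕ.≤_) r ℓ≤stair)))

  -- A coin weighs 2 in an even row and -1 in an odd one, so a fountain weighs 2e - o.

  rowWeight : ℕ → ℤ
  rowWeight zero = + 2
  rowWeight (suc zero) = ℤ.-1ℤ
  rowWeight (suc (suc j)) = rowWeight j

  diagonalWeight : ℕ → ℤ
  diagonalWeight zero = 0ℤ
  diagonalWeight (suc k) = rowWeight k + diagonalWeight k

  rowWeight-double : ∀ ℓ → rowWeight (ℓ ℕ.+ ℓ) ≡ + 2
  rowWeight-double zero = refl
  rowWeight-double (suc ℓ) rewrite ℕ.+-suc ℓ ℓ = rowWeight-double ℓ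

  rowWeight-1+double : ∀ ℓ → rowWeight (suc (ℓ ℕ.+ ℓ)) ≡ ℤ.-1ℤ
  rowWeight-1+double zero = refl
  rowWeight-1+double (suc ℓ) rewrite ℕ.+-suc ℓ ℓ = rowWeight-1+double ℓ

  diagonalWeight-1+double : ∀ ℓ → diagonalWeight (suc (ℓ ℕ.+ ℓ)) ≡ + (2 ℕ.+ ℓ)
  diagonalWeight-double : ∀ ℓ → diagonalWeight (ℓ ℕ.+ ℓ) ≡ + ℓ

  diagonalWeight-1+double ℓ = cong₂ _+_ (rowWeight-double ℓ) (diagonalWeight-double ℓ)

  diagonalWeight-double zero = refl
  diagonalWeight-double (suc ℓ) rewrite ℕ.+-suc ℓ ℓ =
    trans (cong₂ _+_ (rowWeight-1+double ℓ) (diagonalWeight-1+double ℓ)) (cancel (+ ℓ))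
    where
    cancel : ∀ x → ℤ.-1ℤ + (+ 2 + x) ≡ 1ℤ + x
    cancel x = solve (x ∷ [])

  profileWeight : List ℕ → ℤ
  profileWeight = foldr (λ k w → diagonalWeight k + w) 0ℤ

  width-extendLeft : ∀ s e → e - (s - 1ℤ) + 1ℤ ≡ 1ℤ + (e - s + 1ℤ)
  width-extendLeft s e = solve (s ∷ e ∷ [])

  baseWidth-addBaseRow : ∀ ℓ P → baseWidth (addBaseRow ℓ P) ≡ + (2 ℕ.+ ℓ)
  baseWidth-addBaseRow ℓ P = cancel (firstS P) (+ ℓ)
    where
    cancel : ∀ s x → s + x - (s - 1ℤ) + 1ℤ ≡ + 2 + x
    cancel s x = solve (s ∷ x ∷ [])

  leftStair-addBaseRow : ∀ ℓ P → leftStair (addBaseRow ℓ P) ≡ suc (leftStair P)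
  leftStair-addBaseRow ℓ [] = refl
  leftStair-addBaseRow ℓ ((s , e) ∷ rs) =
    cong suc (stairFrom-step (s - 1ℤ) (s , e) rs (sym (i-1+1≡i s)))

  addBaseRow-stanley : ∀ ℓ → IsStanley P → + (2 ℕ.+ ℓ) ≤ baseWidth P → IsStanley (addBaseRow ℓ P)
  addBaseRow-stanley {(s , e) ∷ rs} ℓ st wide =
    i-1<i s , ℤ.i≤i+j s (+ ℓ) , Equivalence.from (<⇔width≥ s e (+ ℓ)) wide , st

  columns-addBaseRow : ∀ ℓ → IsStanley P → columns (addBaseRow ℓ P) ≡ 1ℤ + columns P
  columns-addBaseRow {(s , e) ∷ rs} ℓ _ = begin
    columns ((s - 1ℤ , s + + ℓ) ∷ (s , e) ∷ rs)
      ≡⟨ columns-lastEnd (s - 1ℤ) (s + + ℓ) ((s , e) ∷ rs) ⟩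
    lastEnd e rs - (s - 1ℤ) + 1ℤ
      ≡⟨ width-extendLeft s (lastEnd e rs) ⟩
    1ℤ + (lastEnd e rs - s + 1ℤ)
      ≡⟨ cong (λ x → 1ℤ + x) (columns-lastEnd s e rs) ⟨
    1ℤ + columns ((s , e) ∷ rs)
      ∎
    where open ≡-Reasoning

  area-addBaseRow : ∀ ℓ P → area (addBaseRow ℓ P) ≡ + (2 ℕ.+ ℓ) + area P
  area-addBaseRow ℓ P = cong (_+ area P) (baseWidth-addBaseRow ℓ P)

  extendLeft-[] : ∀ ℓ → extendLeft ℓ [] ≡ []
  extendLeft-[] zero = refl
  extendLeft-[] (suc ℓ) = refl

  extendLeft-stanley : ∀ ℓ → IsStanley P → IsStanley (extendLeft ℓ P)
  extendLeft-stanley zero st = st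
  extendLeft-stanley {(s , e) ∷ []} (suc ℓ) s≤e rewrite extendLeft-[] ℓ =
    ℤ.≤-trans (ℤ.<⇒≤ (i-1<i s)) s≤e
  extendLeft-stanley {(s , e) ∷ (s′ , e′) ∷ rs} (suc zero) (s<s′ , s′≤e , e<e′ , st) =
    ℤ.<-trans (i-1<i s) s<s′ , s′≤e , e<e′ , st
  extendLeft-stanley {(s , e) ∷ (s′ , e′) ∷ rs} (suc (suc ℓ)) (s<s′ , s′≤e , e<e′ , st) =
    i<j⇒i-1<j-1 s<s′ , ℤ.≤-trans (ℤ.<⇒≤ (i-1<i s′)) s′≤e , e<e′ , extendLeft-stanley (suc ℓ) st

  stairFrom-extendLeft : IsStanley ((s , e) ∷ rs) → ℓ ℕ.≤ stairFrom s rs →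
                         stairFrom (s - 1ℤ) (extendLeft ℓ rs) ≡ ℓ
  stairFrom-extendLeft {rs = []} {zero} _ _ = refl
  stairFrom-extendLeft {s} {rs = (s′ , e′) ∷ rs} {zero} (s<s′ , _) _ =
    stairFrom-break (s - 1ℤ) (s′ , e′) rs λ eq → ℤ.<-irrefl (sym (trans eq (i-1+1≡i s))) s<s′
  stairFrom-extendLeft {s} {rs = (s′ , e′) ∷ rs} {suc ℓ} (_ , _ , _ , st) h with s′ ℤ.≟ s + 1ℤ
  ... | yes refl =
    trans (stairFrom-step (s - 1ℤ) (s + 1ℤ - 1ℤ , e′) (extendLeft ℓ rs)
                          (trans (i+1-1≡i s) (sym (i-1+1≡i s))))
          (cong suc (stairFrom-extendLeft st (s≤s⁻¹ h)))
  ... | no _ with () ← h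

  leftStair-extendLeft : IsStanley P → suc ℓ ℕ.≤ leftStair P →
                         leftStair (extendLeft (suc ℓ) P) ≡ suc ℓ
  leftStair-extendLeft {(s , e) ∷ rs} st h = cong suc (stairFrom-extendLeft st (s≤s⁻¹ h))

  baseWidth-extendLeft : ∀ ℓ → IsStanley P → baseWidth (extendLeft (suc ℓ) P) ≡ 1ℤ + baseWidth P
  baseWidth-extendLeft {(s , e) ∷ rs} ℓ _ = width-extendLeft s e

  lastEnd-extendLeft : ∀ ℓ e rs → lastEnd e (extendLeft ℓ rs) ≡ lastEnd e rs
  lastEnd-extendLeft zero e rs = refl
  lastEnd-extendLeft (suc ℓ) e [] = refl
  lastEnd-extendLeft (suc ℓ) e ((_ , e′) ∷ rs) = lastEnd-extendLeft ℓ e′ rs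

  columns-extendLeft : ∀ ℓ → IsStanley P → columns (extendLeft (suc ℓ) P) ≡ 1ℤ + columns P
  columns-extendLeft {(s , e) ∷ rs} ℓ _ = begin
    columns ((s - 1ℤ , e) ∷ extendLeft ℓ rs)
      ≡⟨ columns-lastEnd (s - 1ℤ) e (extendLeft ℓ rs) ⟩
    lastEnd e (extendLeft ℓ rs) - (s - 1ℤ) + 1ℤ
      ≡⟨ cong (λ x → x - (s - 1ℤ) + 1ℤ) (lastEnd-extendLeft ℓ e rs) ⟩
    lastEnd e rs - (s - 1ℤ) + 1ℤ
      ≡⟨ width-extendLeft s (lastEnd e rs) ⟩
    1ℤ + (lastEnd e rs - s + 1ℤ)
      ≡⟨ cong (λ x → 1ℤ + x) (columns-lastEnd s e rs) ⟨
    1ℤ + columns ((s , e) ∷ rs)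
      ∎
    where open ≡-Reasoning

  area-extendLeft : ∀ ℓ P → ℓ ℕ.≤ length P → area (extendLeft ℓ P) ≡ + ℓ + area P
  area-extendLeft zero P _ = sym (ℤ.+-identityˡ (area P))
  area-extendLeft (suc ℓ) ((s , e) ∷ rs) (s≤s ℓ≤) = begin
    (e - (s - 1ℤ) + 1ℤ) + area (extendLeft ℓ rs)
      ≡⟨ cong₂ _+_ (width-extendLeft s e) (area-extendLeft ℓ rs ℓ≤) ⟩
    (1ℤ + (e - s + 1ℤ)) + (+ ℓ + area rs)
      ≡⟨ regroup (e - s + 1ℤ) (+ ℓ) (area rs) ⟩
    1ℤ + + ℓ + ((e - s + 1ℤ) + area rs)
      ∎
    where
    open ≡-Reasoning
    regroup : ∀ w x a → (1ℤ + w) + (x + a) ≡ 1ℤ + x + (w + a)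
    regroup w x a = solve (w ∷ x ∷ a ∷ [])

  record Grows (k : ℕ) (P Q : Rows) : Set where
    field
      stanley : IsStanley Q
      encodes : Encodes k Q
      columns-suc : columns Q ≡ 1ℤ + columns P
      area-+ : area Q ≡ diagonalWeight k + area P

  fStep-grows : IsStanley P → Encodes k′ P → 1 ℕ.≤ k → k ℕ.≤ suc k′ → Grows k P (fStep k P)
  fStep-grows {P} {k = k} st enc 1≤k fits with parity k
  ... | odd ℓ rewrite fStep-odd ℓ P = record
    { stanley = addBaseRow-stanley ℓ st wide
    ; encodes = odd (baseWidth-addBaseRow ℓ P)
                    (subst (suc ℓ ℕ.≤_) (sym (leftStair-addBaseRow ℓ P)) (s≤s ℓ≤stair))
    ; columns-suc = columns-addBaseRow ℓ st
    ; area-+ = trans (area-addBaseRow ℓ P) (cong (_+ area P) (sym (diagonalWeight-1+double ℓ)))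
    }
    where
    ℓ≤stair = proj₁ (Equivalence.to (addBaseRow-fits enc) fits)
    wide = proj₂ (Equivalence.to (addBaseRow-fits enc) fits)
  ... | even zero with () ← 1≤k
  ... | even (suc ℓ) rewrite fStep-even (suc ℓ) P = record
    { stanley = extendLeft-stanley (suc ℓ) st
    ; encodes = even (leftStair-extendLeft st stair≥)
        (subst (+ (3 ℕ.+ ℓ) ≤_) (sym (baseWidth-extendLeft ℓ st)) (ℤ.+-monoʳ-≤ 1ℤ wide))
    ; columns-suc = columns-extendLeft ℓ st
    ; area-+ = trans (area-extendLeft (suc ℓ) P (ℕ.≤-trans stair≥ (leftStair≤length P)))
                    (cong (_+ area P) (sym (diagonalWeight-double (suc ℓ))))
    }
    where
    stair≥ = proj₁ (Equivalence.to (extendLeft-fits enc) fits)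
    wide = proj₂ (Equivalence.to (extendLeft-fits enc) fits)

  -- Heights of the north-east diagonals of a coin fountain, first diagonal first.

  data Profile : List ℕ → Set where
    last : Profile (1 ∷ [])
    cons : ∀ {ks} → 1 ℕ.≤ k → k ℕ.≤ suc k′ → Profile (k′ ∷ ks) → Profile (k ∷ k′ ∷ ks)

  polyominoOf : List ℕ → Rows
  polyominoOf [] = []
  polyominoOf (_ ∷ []) = (0ℤ , 1ℤ) ∷ []
  polyominoOf (k ∷ ks@(_ ∷ _)) = fStep k (polyominoOf ks)

  polyominoOf-grows : ∀ {ks} → Profile (k ∷ k′ ∷ ks) →
                      Grows k (polyominoOf (k′ ∷ ks)) (polyominoOf (k ∷ k′ ∷ ks))
  polyominoOf-stanley : ∀ {ks} → Profile ks → IsStanley (polyominoOf ks)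
  polyominoOf-encodes : ∀ {ks} → Profile (k ∷ ks) → Encodes k (polyominoOf (k ∷ ks))

  polyominoOf-grows (cons 1≤k fits p) =
    fStep-grows (polyominoOf-stanley p) (polyominoOf-encodes p) 1≤k fits

  polyominoOf-stanley last = +≤+ z≤n
  polyominoOf-stanley p@(cons _ _ _) = Grows.stanley (polyominoOf-grows p)

  polyominoOf-encodes last = odd {ℓ = 0} refl (s≤s z≤n)
  polyominoOf-encodes p@(cons _ _ _) = Grows.encodes (polyominoOf-grows p)

  polyominoOf-columns : ∀ {ks} → Profile ks → columns (polyominoOf ks) ≡ + suc (length ks)
  polyominoOf-columns last = refl
  polyominoOf-columns p@(cons _ _ q) =
    trans (Grows.columns-suc (polyominoOf-grows p)) (cong (λ c → 1ℤ + c) (polyominoOf-columns q))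

  polyominoOf-area : ∀ {ks} → Profile ks → area (polyominoOf ks) ≡ profileWeight ks
  polyominoOf-area last = refl
  polyominoOf-area p@(cons {k} _ _ q) =
    trans (Grows.area-+ (polyominoOf-grows p)) (cong (λ w → diagonalWeight k + w) (polyominoOf-area q))

  fStep-cancel : ∀ k → IsStanley P → translate t (fStep k P) ≡ fStep k Q → translate t P ≡ Q
  fStep-cancel {P} {t} {Q} k st eq with parity k
  ... | odd ℓ = List.∷-injectiveʳ (begin
    addBaseRow ℓ (translate t P)           ≡⟨ translate-addBaseRow t ℓ st ⟨
    translate t (addBaseRow ℓ P)           ≡⟨ cong (translate t) (fStep-odd ℓ P) ⟨
    translate t (fStep (suc (ℓ ℕ.+ ℓ)) P)  ≡⟨ eq ⟩
    fStep (suc (ℓ ℕ.+ ℓ)) Q                ≡⟨ fStep-odd ℓ Q ⟩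
    addBaseRow ℓ Q                         ∎)
    where open ≡-Reasoning
  ... | even ℓ = extendLeft-injective ℓ (begin
    extendLeft ℓ (translate t P)           ≡⟨ translate-extendLeft t ℓ P ⟨
    translate t (extendLeft ℓ P)           ≡⟨ cong (translate t) (fStep-even ℓ P) ⟨
    translate t (fStep (ℓ ℕ.+ ℓ) P)        ≡⟨ eq ⟩
    fStep (ℓ ℕ.+ ℓ) Q                      ≡⟨ fStep-even ℓ Q ⟩
    extendLeft ℓ Q                         ∎)
    where open ≡-Reasoning

  polyominoOf-injective : ∀ {ks₁ ks₂} → Profile ks₁ → Profile ks₂ →
                          translate t (polyominoOf ks₁) ≡ polyominoOf ks₂ → ks₁ ≡ ks₂
  polyominoOf-injective last last _ = refl
  polyominoOf-injective {t} last p@(cons _ _ _) eq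
    with () ← ℤ.+-injective (trans (sym (columns-translate t (polyominoOf (1 ∷ []))))
                                  (trans (cong columns eq) (polyominoOf-columns p)))
  polyominoOf-injective {t} {ks₁ = ks₁} p@(cons _ _ _) last eq
    with () ← ℤ.+-injective (trans (sym (polyominoOf-columns p))
                                  (trans (sym (columns-translate t (polyominoOf ks₁))) (cong columns eq)))
  polyominoOf-injective {t} p₁@(cons {k₁} _ _ q₁) p₂@(cons {k₂} _ _ q₂) eq
    with refl ← encodes-unique (encodes-translate t (polyominoOf-encodes p₁))
                               (subst (Encodes k₂) (sym eq) (polyominoOf-encodes p₂))
    = cong (k₁ ∷_) (polyominoOf-injective q₁ q₂ (fStep-cancel k₁ (polyominoOf-stanley q₁) eq))

  -- Surjectivity

  stairFrom-shiftRight : ∀ m s rs → m ℕ.≤ stairFrom s rs →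
                         m ℕ.≤ stairFrom (s + 1ℤ) (shiftRight m rs)
  stairFrom-shiftRight zero s rs _ = z≤n
  stairFrom-shiftRight (suc m) s ((s′ , e′) ∷ rs) h with s′ ℤ.≟ s + 1ℤ
  ... | yes refl =
    subst (suc m ℕ.≤_) (sym (stairFrom-step (s + 1ℤ) (s + 1ℤ + 1ℤ , e′) (shiftRight m rs) refl))
          (s≤s (stairFrom-shiftRight m (s + 1ℤ) rs (s≤s⁻¹ h)))
  ... | no _ with () ← h

  leftStair-shiftRight : ∀ m P → m ℕ.≤ leftStair P → m ℕ.≤ leftStair (shiftRight m P)
  leftStair-shiftRight zero P _ = z≤n
  leftStair-shiftRight (suc m) ((s , e) ∷ rs) h = s≤s (stairFrom-shiftRight m s rs (s≤s⁻¹ h))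

  shiftRight-stanley : IsStanley P → + (2 ℕ.+ leftStair P) ≤ baseWidth P →
                       IsStanley (shiftRight (leftStair P) P)
  shiftRight-stanley {(s , e) ∷ rs} = go s e rs
    where
    go : ∀ s e rs → IsStanley ((s , e) ∷ rs) → + (3 ℕ.+ stairFrom s rs) ≤ e - s + 1ℤ →
         IsStanley ((s + 1ℤ , e) ∷ shiftRight (stairFrom s rs) rs)
    go s e [] _ wide = ℤ.<⇒≤ (Equivalence.from (<⇔width≥ s e 1ℤ) wide)
    go s e ((s′ , e′) ∷ rs) (s<s′ , s′≤e , e<e′ , st) wide with s′ ℤ.≟ s + 1ℤ
    ... | yes refl =
      i<i+1 (s + 1ℤ) , s+2≤e , e<e′ ,
      go (s + 1ℤ) e′ rs st (ℤ.≤-trans (+≤+ (ℕ.n≤1+n _)) (ℤ.≤-trans wide (width-mono s e<e′)))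
      where
      regroup : s + 1ℤ + 1ℤ ≡ s + + 2
      regroup = solve (s ∷ [])
      s+2≤e : s + 1ℤ + 1ℤ ≤ e
      s+2≤e = ℤ.≤-trans (ℤ.≤-reflexive regroup)
                (ℤ.<⇒≤ (Equivalence.from (<⇔width≥ s e (+ 2)) (ℤ.≤-trans (+≤+ (ℕ.m≤m+n 4 _)) wide)))
    ... | no s′≢s+1 = ℤ.≤∧≢⇒< (i<j⇒i+1≤j s<s′) (λ eq → s′≢s+1 (sym eq)) , s′≤e , e<e′ , st

  columns≥3 : IsStanley ((s , e) ∷ (s′ , e′) ∷ rs) → + 3 ≤ columns ((s , e) ∷ (s′ , e′) ∷ rs)
  columns≥3 {s} {e} {s′} {e′} {rs} st@(s<s′ , s′≤e , _) =
    subst (+ 3 ≤_) (sym (columns-lastEnd s e ((s′ , e′) ∷ rs)))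
      (Equivalence.to (<⇔width≥ s (lastEnd e′ rs) 1ℤ)
        (ℤ.≤-<-trans (ℤ.≤-trans (i<j⇒i+1≤j s<s′) s′≤e) (lastEnd-stanley st)))

  Preimage : Rows → Set
  Preimage P = ∃[ k ] ∃[ ks ] Profile (k ∷ ks) × ∃[ t ] translate t (polyominoOf (k ∷ ks)) ≡ P

  SurjectiveAt : ℕ → Set
  SurjectiveAt n = ∀ P → IsStanley P → columns P ≡ + (2 ℕ.+ n) → Preimage P

  twoColumns-preimage : SurjectiveAt 0
  twoColumns-preimage ((s , e) ∷ []) _ cols =
    1 , [] , last , s , cong (_∷ []) (cong₂ _,_ (ℤ.+-identityˡ s) e≡1+s)
    where
    open ≡-Reasoning
    e≡1+s : 1ℤ + s ≡ e
    e≡1+s = begin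
      1ℤ + s              ≡⟨ solve (s ∷ []) ⟩
      + 2 + s - 1ℤ        ≡⟨ cong (λ w → w + s - 1ℤ) cols ⟨
      e - s + 1ℤ + s - 1ℤ ≡⟨ solve (e ∷ s ∷ []) ⟩
      e                   ∎
  twoColumns-preimage ((s , e) ∷ (s′ , e′) ∷ rs) st cols
    with s≤s (s≤s ()) ← ℤ.drop‿+≤+ (subst (+ 3 ≤_) cols (columns≥3 st))

  addBaseRow-preimage : ∀ ℓ → Preimage Q → ℓ ℕ.≤ leftStair Q → + (2 ℕ.+ ℓ) ≤ baseWidth Q →
                        Preimage (addBaseRow ℓ Q)
  addBaseRow-preimage ℓ (k , ks , p , t , refl) ℓ≤stair wide =
    suc (ℓ ℕ.+ ℓ) , k ∷ ks , cons (s≤s z≤n) fits p , t , (begin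
      translate t (fStep (suc (ℓ ℕ.+ ℓ)) R)  ≡⟨ cong (translate t) (fStep-odd ℓ R) ⟩
      translate t (addBaseRow ℓ R)           ≡⟨ translate-addBaseRow t ℓ (polyominoOf-stanley p) ⟩
      addBaseRow ℓ (translate t R)           ∎)
    where
    open ≡-Reasoning
    R = polyominoOf (k ∷ ks)
    fits = Equivalence.from (addBaseRow-fits (encodes-translate t (polyominoOf-encodes p))) (ℓ≤stair , wide)

  extendLeft-preimage : ∀ ℓ → Preimage Q → suc ℓ ℕ.≤ leftStair Q → + (2 ℕ.+ ℓ) ≤ baseWidth Q →
                        Preimage (extendLeft (suc ℓ) Q)
  extendLeft-preimage ℓ (k , ks , p , t , refl) stair≥ wide =
    suc ℓ ℕ.+ suc ℓ , k ∷ ks , cons (s≤s z≤n) fits p , t , (begin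
      translate t (fStep (suc ℓ ℕ.+ suc ℓ) R)  ≡⟨ cong (translate t) (fStep-even (suc ℓ) R) ⟩
      translate t (extendLeft (suc ℓ) R)       ≡⟨ translate-extendLeft t (suc ℓ) R ⟩
      extendLeft (suc ℓ) (translate t R)       ∎)
    where
    open ≡-Reasoning
    R = polyominoOf (k ∷ ks)
    fits = Equivalence.from (extendLeft-fits (encodes-translate t (polyominoOf-encodes p))) (stair≥ , wide)

  narrow-preimage : SurjectiveAt n → IsStanley P → columns P ≡ + (3 ℕ.+ n) →
                    baseWidth P ≤ + (1 ℕ.+ leftStair P) → Preimage P
  narrow-preimage {P = (s , e) ∷ []} _ _ cols narrow
    with s≤s (s≤s ()) ← ℤ.drop‿+≤+ (subst (_≤ + 2) cols narrow)
  narrow-preimage {n} {(s , e) ∷ (s′ , e′) ∷ rs} ih (s<s′ , s′≤e , e<e′ , st) cols narrow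
    with s′ ℤ.≟ s + 1ℤ
  ... | no s′≢s+1 = contradiction (ℤ.drop‿+≤+ (ℤ.≤-trans wide narrow)) (ℕ.<⇒≱ (ℕ.n<1+n 2))
    where
    s+1<s′ : s + 1ℤ < s′
    s+1<s′ = ℤ.≤∧≢⇒< (i<j⇒i+1≤j s<s′) (λ eq → s′≢s+1 (sym eq))
    wide : + 3 ≤ e - s + 1ℤ
    wide = Equivalence.to (<⇔width≥ s e 1ℤ) (ℤ.<-≤-trans s+1<s′ s′≤e)
  ... | yes refl with u , refl ← ≤⇒offset s′≤e =
    subst Preimage (sym P≡)
      (addBaseRow-preimage u (ih P′ st cols′) u≤stair (Equivalence.to (<⇔width≥ (s + 1ℤ) e′ (+ u)) e<e′))
    where
    P′ = (s + 1ℤ , e′) ∷ rs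
    P≡ : (s , s + 1ℤ + + u) ∷ P′ ≡ addBaseRow u P′
    P≡ = cong (λ a → (a , s + 1ℤ + + u) ∷ P′) (sym (i+1-1≡i s))
    cols′ : columns P′ ≡ + (2 ℕ.+ n)
    cols′ = +-cancelˡ-≡ 1ℤ (trans (sym (columns-addBaseRow u st)) (trans (cong columns (sym P≡)) cols))
    u≤stair : u ℕ.≤ leftStair P′
    u≤stair = s≤s⁻¹ (s≤s⁻¹ (ℤ.drop‿+≤+ (subst (_≤ + (2 ℕ.+ leftStair P′))
                (trans (cong baseWidth P≡) (baseWidth-addBaseRow u P′)) narrow)))

  wide-preimage : SurjectiveAt n → IsStanley P → columns P ≡ + (3 ℕ.+ n) →
                  + (2 ℕ.+ leftStair P) ≤ baseWidth P → Preimage P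
  wide-preimage {n} {P@((s , e) ∷ rs)} ih st cols wide =
    subst Preimage P≡
      (extendLeft-preimage (stairFrom s rs) (ih P′ st′ cols′) (leftStair-shiftRight r P ℕ.≤-refl) wide′)
    where
    r = leftStair P
    P′ = shiftRight r P
    P≡ : extendLeft r P′ ≡ P
    P≡ = extendLeft-shiftRight r P
    st′ : IsStanley P′
    st′ = shiftRight-stanley st wide
    cols′ : columns P′ ≡ + (2 ℕ.+ n)
    cols′ = +-cancelˡ-≡ 1ℤ
              (trans (sym (columns-extendLeft (stairFrom s rs) st′)) (trans (cong columns P≡) cols))
    wide′ : + (1 ℕ.+ r) ≤ baseWidth P′
    wide′ = 1+-cancel-≤ (subst (+ (2 ℕ.+ r) ≤_)
              (trans (cong baseWidth (sym P≡)) (baseWidth-extendLeft (stairFrom s rs) st′)) wide)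

  polyominoOf-surjective : ∀ n → SurjectiveAt n
  polyominoOf-surjective zero = twoColumns-preimage
  polyominoOf-surjective (suc n) P st cols with baseWidth P ℤ.≤? + (1 ℕ.+ leftStair P)
  ... | yes narrow = narrow-preimage (polyominoOf-surjective n) st cols narrow
  ... | no ¬narrow = wide-preimage (polyominoOf-surjective n) st cols (ℤ.i<j⇒suc[i]≤j (ℤ.≰⇒> ¬narrow))

module Fountains where

  open Polyominoes
    using (Profile; last; cons; polyominoOf; polyominoOf-stanley; polyominoOf-columns; polyominoOf-area;
           polyominoOf-injective; polyominoOf-surjective; rowWeight; diagonalWeight; profileWeight;
           translate; translate-identity; translate⇒≈T; ≈T⇒translate; +-cancelʳ-≡; ≤⇒offset)

  open import Data.Integer.Base as ℤ using (ℤ; +_; _-_; 0ℤ; 1ℤ)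
  import Data.Integer.Properties as ℤ
  import Data.Integer.Tactic.RingSolver as ℤSolver
  open import Data.List.Base using (List; []; _∷_; _++_; map; filter; length; applyDownFrom; applyUpTo)
  import Data.List.Properties as List
  open import Data.List.Membership.Propositional using (_∈_)
  open import Data.List.Membership.Propositional.Properties
    using (∈-++⁻; ∈-++⁺ˡ; ∈-++⁺ʳ; ∈-map⁻; ∈-map⁺; ∈-applyDownFrom⁻; ∈-applyDownFrom⁺; ∈-∃++)
  open import Data.List.Relation.Unary.All as All using (All)
  import Data.List.Relation.Unary.All.Properties as All
  open import Data.List.Relation.Unary.Any using (here; there)
  import Data.List.Relation.Unary.AllPairs as AllPairs
  open import Data.List.Relation.Unary.Unique.Propositional using (Unique)
  import Data.List.Relation.Unary.Unique.Propositional.Properties as Unique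
  open import Data.List.Relation.Binary.Subset.Propositional using (_⊆_)
  import Data.List.Relation.Binary.Subset.Propositional.Properties as Subset
  open import Data.List.Relation.Binary.Permutation.Propositional.Properties using (shift; ↭-length)
  open import Data.Nat.Base using (ℕ; zero; suc; _+_; _*_; _≤_; _<_; z≤n; s≤s; s≤s⁻¹)
  import Data.Nat.Properties as ℕ
  open import Data.List.Extrema ℕ.≤-totalOrder using (max; xs≤max)
  open import Data.Nat.DivMod using (_%_)
  open import Data.Nat.Tactic.RingSolver using (solve-∀)
  open import Data.Product.Base using (_×_; _,_; proj₁; proj₂; ∃-syntax)
  open import Data.Product.Properties using (≡-dec)
  open import Data.Sum.Base using (_⊎_; inj₁; inj₂)
  open import Function.Base using (_∘_; id)
  open import Function.Bundles using (_⇔_; mk⇔; Equivalence)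
  import Function.Properties.Equivalence as ⇔
  open import Relation.Nullary using (Dec; yes; no; ¬_; contradiction)
  open import Relation.Binary.PropositionalEquality

  length-mono-⊆ : ∀ {A : Set} {xs ys : List A} → Unique xs → xs ⊆ ys → length xs ≤ length ys
  length-mono-⊆ {xs = []} _ _ = z≤n
  length-mono-⊆ {xs = x ∷ xs} u x∷xs⊆ys with ys₁ , ys₂ , refl ← ∈-∃++ (x∷xs⊆ys (here refl)) = begin
    suc (length xs)             ≤⟨ s≤s (length-mono-⊆ (AllPairs.tail u) xs⊆ys₁++ys₂) ⟩
    suc (length (ys₁ ++ ys₂))   ≡⟨ ↭-length (shift x ys₁ ys₂) ⟨
    length (ys₁ ++ x ∷ ys₂)     ∎
    where
    open ℕ.≤-Reasoning
    xs⊆ys₁++ys₂ : xs ⊆ ys₁ ++ ys₂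
    xs⊆ys₁++ys₂ = Subset.⊆∷∧∉⇒⊆ (Subset.⊆-respʳ-↭ (shift x ys₁ ys₂) (x∷xs⊆ys ∘ there))
                                (Unique.Unique[x∷xs]⇒x∉xs u)

  SameElements : ∀ {A : Set} → List A → List A → Set
  SameElements xs ys = ∀ {x} → x ∈ xs ⇔ x ∈ ys

  length-cong : ∀ {A : Set} {xs ys : List A} → Unique xs → Unique ys → SameElements xs ys →
                length xs ≡ length ys
  length-cong uxs uys xs≈ys =
    ℕ.≤-antisym (length-mono-⊆ uxs (Equivalence.to xs≈ys)) (length-mono-⊆ uys (Equivalence.from xs≈ys))

  filter-cong : ∀ {P : Coin → Set} (P? : ∀ x → Dec (P x)) {xs ys} →
                SameElements xs ys → SameElements (filter P? xs) (filter P? ys)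
  filter-cong P? xs≈ys = mk⇔ (Subset.filter⁺′ P? P? id (Equivalence.to xs≈ys))
                             (Subset.filter⁺′ P? P? id (Equivalence.from xs≈ys))

  count-cong : ∀ {P : Coin → Set} (P? : ∀ x → Dec (P x)) {xs ys} → Unique xs → Unique ys →
               SameElements xs ys → length (filter P? xs) ≡ length (filter P? ys)
  count-cong P? uxs uys xs≈ys =
    length-cong (Unique.filter⁺ P? uxs) (Unique.filter⁺ P? uys) (filter-cong P? xs≈ys)

  -- f depends only on the set of coins

  onFirstDiagonal? : (x : Coin) → Dec (proj₁ x ≡ + proj₂ x)
  onFirstDiagonal? x = proj₁ x ℤ.≟ + proj₂ x

  offFirstDiagonal? : (x : Coin) → Dec (+ 2 ℤ.≤ proj₁ x - + proj₂ x)
  offFirstDiagonal? x = + 2 ℤ.≤? proj₁ x - + proj₂ x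

  previousDiagonal : Coin → Coin
  previousDiagonal (a , j) = (a - + 2 , j)

  previousDiagonal-injective : ∀ {x y} → previousDiagonal x ≡ previousDiagonal y → x ≡ y
  previousDiagonal-injective {a , j} {b , _} eq =
    cong₂ _,_ (+-cancelʳ-≡ (ℤ.- + 2) (cong proj₁ eq)) (cong proj₂ eq)

  deleteFirstDiag-cong : ∀ {xs ys} → SameElements xs ys → SameElements (deleteFirstDiag xs) (deleteFirstDiag ys)
  deleteFirstDiag-cong xs≈ys = mk⇔ (Subset.map⁺ previousDiagonal (Equivalence.to filtered))
                                   (Subset.map⁺ previousDiagonal (Equivalence.from filtered))
    where
    filtered = filter-cong offFirstDiagonal? xs≈ys

  deleteFirstDiag-unique : ∀ {xs} → Unique xs → Unique (deleteFirstDiag xs)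
  deleteFirstDiag-unique u = Unique.map⁺ previousDiagonal-injective (Unique.filter⁺ offFirstDiagonal? u)

  fRaw-cong : ∀ d {xs ys} → Unique xs → Unique ys → SameElements xs ys → fRaw d xs ≡ fRaw d ys
  fRaw-cong zero _ _ _ = refl
  fRaw-cong (suc zero) _ _ _ = refl
  fRaw-cong (suc (suc d)) uxs uys xs≈ys = cong₂ fStep
    (count-cong onFirstDiagonal? uxs uys xs≈ys)
    (fRaw-cong (suc d) (deleteFirstDiag-unique uxs) (deleteFirstDiag-unique uys) (deleteFirstDiag-cong xs≈ys))

  -- The coin fountain with a given profile

  coin : ℕ → ℕ → Coin
  coin p j = (+ (2 * p + j) , j)

  nextDiagonal : Coin → Coin
  nextDiagonal (a , j) = (a ℤ.+ + 2 , j)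

  nextDiagonal-coin : ∀ p j → nextDiagonal (coin p j) ≡ coin (suc p) j
  nextDiagonal-coin p j = cong (λ n → (+ n , j)) (regroup p j)
    where
    regroup : ∀ p j → 2 * p + j + 2 ≡ 2 * suc p + j
    regroup = solve-∀

  coin-leftSupport : ∀ p j → proj₁ (coin p (suc j)) - 1ℤ ≡ proj₁ (coin p j)
  coin-leftSupport p j rewrite ℕ.+-suc (2 * p) j = refl

  coin-rightSupport : ∀ p j → proj₁ (coin p (suc j)) ℤ.+ 1ℤ ≡ proj₁ (coin (suc p) j)
  coin-rightSupport p j = cong +_ (regroup p j)
    where
    regroup : ∀ p j → 2 * p + suc j + 1 ≡ 2 * suc p + j
    regroup = solve-∀

  firstDiagonal : ℕ → List Coin
  firstDiagonal = applyDownFrom (λ j → (+ j , j))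

  coinsOf : List ℕ → List Coin
  coinsOf [] = []
  coinsOf (k ∷ ks) = firstDiagonal k ++ map nextDiagonal (coinsOf ks)

  height : List ℕ → ℕ → ℕ
  height [] _ = 0
  height (k ∷ _) zero = k
  height (_ ∷ ks) (suc p) = height ks p

  ∈-coinsOf : ∀ ks {a j} → (a , j) ∈ coinsOf ks ⇔ (∃[ p ] a ≡ + (2 * p + j) × j < height ks p)
  ∈-coinsOf [] = mk⇔ (λ ()) (λ ())
  ∈-coinsOf (k ∷ ks) {a} {j} = mk⇔ to from
    where
    to : (a , j) ∈ coinsOf (k ∷ ks) → ∃[ p ] a ≡ + (2 * p + j) × j < height (k ∷ ks) p
    to m with ∈-++⁻ (firstDiagonal k) m
    ... | inj₁ m₀ with _ , j<k , refl ← ∈-applyDownFrom⁻ _ m₀ = 0 , refl , j<k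
    ... | inj₂ m₁ with (b , _) , m′ , refl ← ∈-map⁻ nextDiagonal m₁
                  with p , refl , j<h ← Equivalence.to (∈-coinsOf ks) m′ =
      suc p , cong proj₁ (nextDiagonal-coin p j) , j<h
    from : ∃[ p ] a ≡ + (2 * p + j) × j < height (k ∷ ks) p → (a , j) ∈ coinsOf (k ∷ ks)
    from (zero , refl , j<k) = ∈-++⁺ˡ (∈-applyDownFrom⁺ _ j<k)
    from (suc p , refl , j<h) = ∈-++⁺ʳ (firstDiagonal k)
      (subst (_∈ map nextDiagonal (coinsOf ks)) (nextDiagonal-coin p j)
        (∈-map⁺ nextDiagonal (Equivalence.from (∈-coinsOf ks) (p , refl , j<h))))

  coinsOf-rightOfFirstDiagonal : ∀ ks → All (λ x → + proj₂ x ℤ.≤ proj₁ x) (coinsOf ks)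
  coinsOf-rightOfFirstDiagonal ks = All.tabulate λ {(a , j)} m →
    let p , a≡ , _ = Equivalence.to (∈-coinsOf ks) m
    in subst (+ j ℤ.≤_) (sym a≡) (ℤ.+≤+ (ℕ.m≤n+m j (2 * p)))

  firstDiagonal-on : ∀ k → All (λ x → proj₁ x ≡ + proj₂ x) (firstDiagonal k)
  firstDiagonal-on k = All.applyDownFrom⁺₂ _ k (λ _ → refl)

  firstDiagonal-¬off : ∀ k → All (λ x → ¬ (+ 2 ℤ.≤ proj₁ x - + proj₂ x)) (firstDiagonal k)
  firstDiagonal-¬off k = All.applyDownFrom⁺₂ _ k λ j h →
    contradiction (ℤ.drop‿+≤+ (subst (+ 2 ℤ.≤_) (ℤ.+-inverseʳ (+ j)) h)) λ ()

  nextDiagonal-off : ∀ ks → All (λ x → + 2 ℤ.≤ proj₁ x - + proj₂ x) (map nextDiagonal (coinsOf ks))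
  nextDiagonal-off ks = All.map⁺ (All.map off (coinsOf-rightOfFirstDiagonal ks))
    where
    off : ∀ {x} → + proj₂ x ℤ.≤ proj₁ x → + 2 ℤ.≤ proj₁ x ℤ.+ + 2 - + proj₂ x
    off {a , j} j≤a = begin
      + 2                    ≡⟨ ℤ.+-identityʳ (+ 2) ⟨
      + 2 ℤ.+ 0ℤ             ≤⟨ ℤ.+-monoʳ-≤ (+ 2) (ℤ.i≤j⇒0≤j-i j≤a) ⟩
      + 2 ℤ.+ (a - + j)      ≡⟨ regroup a (+ j) ⟩
      a ℤ.+ + 2 - + j        ∎
      where
      open ℤ.≤-Reasoning
      regroup : ∀ a b → + 2 ℤ.+ (a - b) ≡ a ℤ.+ + 2 - b
      regroup = ℤSolver.solve-∀

  nextDiagonal-¬on : ∀ ks → All (λ x → proj₁ x ≢ + proj₂ x) (map nextDiagonal (coinsOf ks))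
  nextDiagonal-¬on ks = All.map (λ {(a , j)} off eq → contradiction (subst (λ b → + 2 ℤ.≤ b - + j) eq off)
                                                     (All.lookup (firstDiagonal-¬off (suc j)) (here refl)))
                             (nextDiagonal-off ks)

  nextDiagonal-injective : ∀ {x y} → nextDiagonal x ≡ nextDiagonal y → x ≡ y
  nextDiagonal-injective eq = cong₂ _,_ (+-cancelʳ-≡ (+ 2) (cong proj₁ eq)) (cong proj₂ eq)

  coinsOf-unique : ∀ ks → Unique (coinsOf ks)
  coinsOf-unique [] = AllPairs.[]
  coinsOf-unique (k ∷ ks) = Unique.++⁺
    (Unique.applyDownFrom⁺₁ _ k λ j<i _ eq → ℕ.<⇒≢ j<i (sym (cong proj₂ eq)))
    (Unique.map⁺ nextDiagonal-injective (coinsOf-unique ks))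
    (λ (on , notOn) → All.lookup (nextDiagonal-¬on ks) notOn (All.lookup (firstDiagonal-on k) on))

  diagL-coinsOf : ∀ k ks → diagL (coinsOf (k ∷ ks)) ≡ k
  diagL-coinsOf k ks = begin
    length (filter onFirstDiagonal? (firstDiagonal k ++ map nextDiagonal (coinsOf ks)))
      ≡⟨ cong length (List.filter-++ onFirstDiagonal? (firstDiagonal k) _) ⟩
    length (filter onFirstDiagonal? (firstDiagonal k) ++ filter onFirstDiagonal? (map nextDiagonal (coinsOf ks)))
      ≡⟨ cong₂ (λ xs ys → length (xs ++ ys)) (List.filter-all onFirstDiagonal? (firstDiagonal-on k))
                                              (List.filter-none onFirstDiagonal? (nextDiagonal-¬on ks)) ⟩
    length (firstDiagonal k ++ [])
      ≡⟨ cong length (List.++-identityʳ (firstDiagonal k)) ⟩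
    length (firstDiagonal k)
      ≡⟨ List.length-applyDownFrom _ k ⟩
    k ∎
    where open ≡-Reasoning

  deleteFirstDiag-coinsOf : ∀ k ks → deleteFirstDiag (coinsOf (k ∷ ks)) ≡ coinsOf ks
  deleteFirstDiag-coinsOf k ks = begin
    map previousDiagonal (filter offFirstDiagonal? (firstDiagonal k ++ map nextDiagonal (coinsOf ks)))
      ≡⟨ cong (map previousDiagonal) (List.filter-++ offFirstDiagonal? (firstDiagonal k) _) ⟩
    map previousDiagonal (filter offFirstDiagonal? (firstDiagonal k)
                          ++ filter offFirstDiagonal? (map nextDiagonal (coinsOf ks)))
      ≡⟨ cong₂ (λ xs ys → map previousDiagonal (xs ++ ys))
               (List.filter-none offFirstDiagonal? (firstDiagonal-¬off k))
               (List.filter-all offFirstDiagonal? (nextDiagonal-off ks)) ⟩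
    map previousDiagonal (map nextDiagonal (coinsOf ks))
      ≡⟨ List.map-∘ (coinsOf ks) ⟨
    map (previousDiagonal ∘ nextDiagonal) (coinsOf ks)
      ≡⟨ List.map-cong (λ (a , j) → cong (_, j) (cancel a)) (coinsOf ks) ⟩
    map id (coinsOf ks)
      ≡⟨ List.map-id (coinsOf ks) ⟩
    coinsOf ks ∎
    where
    open ≡-Reasoning
    cancel : ∀ a → a ℤ.+ + 2 - + 2 ≡ a
    cancel = ℤSolver.solve-∀

  fRaw-coinsOf : ∀ {ks} → Profile ks → fRaw (length ks) (coinsOf ks) ≡ polyominoOf ks
  fRaw-coinsOf last = refl
  fRaw-coinsOf (cons {k} {k′} {ks} _ _ p) = cong₂ fStep (diagL-coinsOf k (k′ ∷ ks))
    (trans (cong (fRaw (suc (length ks))) (deleteFirstDiag-coinsOf k (k′ ∷ ks))) (fRaw-coinsOf p))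

  profile-nonempty : ∀ {ks} → Profile ks → 1 ≤ length ks
  profile-nonempty last = s≤s z≤n
  profile-nonempty (cons _ _ _) = s≤s z≤n

  height-pos : ∀ {ks} → Profile ks → ∀ p → p < length ks → 1 ≤ height ks p
  height-pos last zero _ = s≤s z≤n
  height-pos last (suc p) (s≤s ())
  height-pos (cons 1≤k _ _) zero _ = 1≤k
  height-pos (cons _ _ q) (suc p) p<len = height-pos q p (s≤s⁻¹ p<len)

  height-beyond : ∀ ks p → length ks ≤ p → height ks p ≡ 0
  height-beyond [] p _ = refl
  height-beyond (_ ∷ ks) (suc p) len≤p = height-beyond ks p (s≤s⁻¹ len≤p)

  height-step : ∀ {ks} → Profile ks → ∀ p → height ks p ≤ suc (height ks (suc p))
  height-step last zero = s≤s z≤n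
  height-step last (suc p) = z≤n
  height-step (cons _ k≤ _) zero = k≤
  height-step (cons _ _ q) (suc p) = height-step q p

  fountainOf : ∀ {ks} → Profile ks → CoinFountain
  fountainOf {ks} p = record
    { d = length ks
    ; d≥1 = profile-nonempty p
    ; coins = coinsOf ks
    ; unique = coinsOf-unique ks
    ; row0 = λ a → mk⇔ (on-row0 a) (row0-on a)
    ; support = supported
    }
    where
    on-row0 : ∀ a → (a , 0) ∈ coinsOf ks → ∃[ i ] i < length ks × a ≡ + (2 * i)
    on-row0 a m with i , refl , 0<h ← Equivalence.to (∈-coinsOf ks) m with i ℕ.<? length ks
    ... | yes i<len = i , i<len , cong +_ (ℕ.+-identityʳ (2 * i))
    ... | no i≮len with () ← subst (0 <_) (height-beyond ks i (ℕ.≮⇒≥ i≮len)) 0<h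
    row0-on : ∀ a → ∃[ i ] i < length ks × a ≡ + (2 * i) → (a , 0) ∈ coinsOf ks
    row0-on a (i , i<len , refl) =
      Equivalence.from (∈-coinsOf ks) (i , cong +_ (sym (ℕ.+-identityʳ (2 * i))) , height-pos p i i<len)
    supported : ∀ a j → (a , suc j) ∈ coinsOf ks →
                ((a - 1ℤ , j) ∈ coinsOf ks) × ((a ℤ.+ 1ℤ , j) ∈ coinsOf ks)
    supported a j m with i , refl , 1+j<h ← Equivalence.to (∈-coinsOf ks) m =
      Equivalence.from (∈-coinsOf ks) (i , coin-leftSupport i j , ℕ.<⇒≤ 1+j<h) ,
      Equivalence.from (∈-coinsOf ks)
        (suc i , coin-rightSupport i j , s≤s⁻¹ (ℕ.≤-trans 1+j<h (height-step p i)))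

  f-fountainOf : ∀ {ks} (p : Profile ks) → f (fountainOf p) ≡ polyominoOf ks
  f-fountainOf = fRaw-coinsOf

  -- The profile of a coin fountain

  initialSegment : ∀ {Q : ℕ → Set} → (∀ j → Dec (Q j)) → (∀ {j} → Q (suc j) → Q j) →
                   ∀ M → ¬ Q M → ∃[ K ] (∀ j → Q j ⇔ j < K)
  initialSegment {Q} Q? down = go
    where
    downward : ∀ {i j} → i ≤ j → Q j → Q i
    downward {j = zero} z≤n q = q
    downward {j = suc j} i≤1+j q with ℕ.m≤n⇒m<n∨m≡n i≤1+j
    ... | inj₁ i<1+j = downward (s≤s⁻¹ i<1+j) (down q)
    ... | inj₂ refl = q
    go : ∀ M → ¬ Q M → ∃[ K ] (∀ j → Q j ⇔ j < K)
    go zero ¬Q0 = 0 , λ j → mk⇔ (λ q → contradiction (downward z≤n q) ¬Q0) λ ()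
    go (suc M) ¬Q1+M with Q? M
    ... | yes QM = suc M , λ j → mk⇔ (λ q → ℕ.≰⇒> λ 1+M≤j → ¬Q1+M (downward 1+M≤j q))
                                     (λ j<1+M → downward (s≤s⁻¹ j<1+M) QM)
    ... | no ¬QM = go M ¬QM

  height-applyUpTo : ∀ K n p → (∀ q → n ≤ q → K q ≡ 0) → height (applyUpTo K n) p ≡ K p
  height-applyUpTo K zero p vanish = sym (vanish p z≤n)
  height-applyUpTo K (suc n) zero _ = refl
  height-applyUpTo K (suc n) (suc p) vanish =
    height-applyUpTo (K ∘ suc) n p (λ q n≤q → vanish (suc q) (s≤s n≤q))

  applyUpTo-profile : ∀ K n → (∀ p → p ≤ n → 1 ≤ K p) → (∀ p → K p ≤ suc (K (suc p))) →
                      K (suc n) ≡ 0 → Profile (applyUpTo K (suc n))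
  applyUpTo-profile K zero pos step K1≡0 = subst (λ k → Profile (k ∷ [])) (sym K0≡1) last
    where
    K0≡1 : K 0 ≡ 1
    K0≡1 = ℕ.≤-antisym (subst (λ h → K 0 ≤ suc h) K1≡0 (step 0)) (pos 0 z≤n)
  applyUpTo-profile K (suc n) pos step vanish =
    cons (pos 0 z≤n) (step 0)
         (applyUpTo-profile (K ∘ suc) n (λ p p≤n → pos (suc p) (s≤s p≤n)) (step ∘ suc) vanish)

  _≟-coin_ : (x y : Coin) → Dec (x ≡ y)
  _≟-coin_ = ≡-dec ℤ._≟_ ℕ._≟_

  open import Data.List.Membership.DecPropositional _≟-coin_ using (_∈?_)

  module _ (C : CoinFountain) where

    private
      maxRow : ℕ
      maxRow = max 0 (map proj₂ (coins C))

      row≤maxRow : ∀ {a j} → (a , j) ∈ coins C → j ≤ maxRow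
      row≤maxRow m = All.lookup (xs≤max 0 (map proj₂ (coins C))) (∈-map⁺ proj₂ m)

      -- A coin rests on the one below it on its diagonal, so the heights of the coins on a
      -- diagonal form an initial segment of ℕ, bounded above by the highest row.
      below : ∀ p {j} → coin p (suc j) ∈ coins C → coin p j ∈ coins C
      below p {j} m = subst (λ a → (a , j) ∈ coins C) (coin-leftSupport p j) (proj₁ (support C _ j m))

      heightOf : ∀ p → ∃[ K ] (∀ j → coin p j ∈ coins C ⇔ j < K)
      heightOf p = initialSegment (λ j → coin p j ∈? coins C) (below p) (suc maxRow)
                                  (λ m → ℕ.<-irrefl refl (row≤maxRow m))

    diagonalHeight : ℕ → ℕ
    diagonalHeight p = proj₁ (heightOf p)

    diagonalHeight-spec : ∀ p j → coin p j ∈ coins C ⇔ j < diagonalHeight p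
    diagonalHeight-spec p = proj₂ (heightOf p)

    onDiagonal : ∀ {a j} → (a , j) ∈ coins C → ∃[ p ] a ≡ + (2 * p + j)
    onDiagonal {a} {zero} m with p , _ , a≡ ← Equivalence.to (row0 C a) m =
      p , trans a≡ (cong +_ (sym (ℕ.+-identityʳ _)))
    onDiagonal {a} {suc j} m with p , a-1≡ ← onDiagonal (proj₁ (support C a j m)) =
      p , +-cancelʳ-≡ ℤ.-1ℤ (trans a-1≡ (sym (coin-leftSupport p j)))

    ∈-coins : ∀ {a j} → (a , j) ∈ coins C ⇔ (∃[ p ] a ≡ + (2 * p + j) × j < diagonalHeight p)
    ∈-coins {a} {j} = mk⇔
      (λ m → let p , a≡ = onDiagonal m in
             p , a≡ , Equivalence.to (diagonalHeight-spec p j) (subst (λ a → (a , j) ∈ coins C) a≡ m))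
      (λ (p , a≡ , j<h) →
        subst (λ a → (a , j) ∈ coins C) (sym a≡) (Equivalence.from (diagonalHeight-spec p j) j<h))

    diagonalHeight-pos : ∀ p → p < d C → 1 ≤ diagonalHeight p
    diagonalHeight-pos p p<d = Equivalence.to (diagonalHeight-spec p 0)
      (subst (λ a → (a , 0) ∈ coins C) (cong +_ (sym (ℕ.+-identityʳ (2 * p))))
        (Equivalence.from (row0 C _) (p , p<d , refl)))

    diagonalHeight-beyond : ∀ p → d C ≤ p → diagonalHeight p ≡ 0
    diagonalHeight-beyond p d≤p = ℕ.n≤0⇒n≡0 (ℕ.≮⇒≥ λ 0<h →
      let i , i<d , 2p≡2i = Equivalence.to (row0 C _) (Equivalence.from (diagonalHeight-spec p 0) 0<h)
          p≡i = ℕ.*-cancelˡ-≡ p i 2 (trans (sym (ℕ.+-identityʳ (2 * p))) (ℤ.+-injective 2p≡2i))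
      in ℕ.<-irrefl (sym p≡i) (ℕ.<-≤-trans i<d d≤p))

    diagonalHeight-step : ∀ p → diagonalHeight p ≤ suc (diagonalHeight (suc p))
    diagonalHeight-step p = ℕ.≮⇒≥ λ h →
      ℕ.<-irrefl refl (Equivalence.to (diagonalHeight-spec (suc p) H)
        (subst (λ a → (a , H) ∈ coins C) (coin-rightSupport p H)
          (proj₂ (support C _ H (Equivalence.from (diagonalHeight-spec p (suc H)) h)))))
      where
      H = diagonalHeight (suc p)

    profileOf : List ℕ
    profileOf = applyUpTo diagonalHeight (d C)

    profileOf-profile : Profile (applyUpTo diagonalHeight (d C))
    profileOf-profile with d C in eq | d≥1 C
    ... | suc n | _ = applyUpTo-profile diagonalHeight n
      (λ p p≤n → diagonalHeight-pos p (subst (p <_) (sym eq) (s≤s p≤n)))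
      diagonalHeight-step
      (diagonalHeight-beyond (suc n) (ℕ.≤-reflexive eq))

    ∈-profileOf : SameElements (coins C) (coinsOf profileOf)
    ∈-profileOf {a , j} = mk⇔
      (λ m → let p , a≡ , j<h = Equivalence.to ∈-coins m in
             Equivalence.from (∈-coinsOf profileOf) (p , a≡ , subst (j <_) (sym (height-profileOf p)) j<h))
      (λ m → let p , a≡ , j<h = Equivalence.to (∈-coinsOf profileOf) m in
             Equivalence.from ∈-coins (p , a≡ , subst (j <_) (height-profileOf p) j<h))
      where
      height-profileOf : ∀ p → height profileOf p ≡ diagonalHeight p
      height-profileOf p = height-applyUpTo diagonalHeight (d C) p diagonalHeight-beyond

    f-profileOf : f C ≡ polyominoOf profileOf
    f-profileOf = begin
      fRaw (d C) (coins C)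
        ≡⟨ fRaw-cong (d C) (unique C) (coinsOf-unique profileOf) ∈-profileOf ⟩
      fRaw (d C) (coinsOf profileOf)
        ≡⟨ cong (λ n → fRaw n (coinsOf profileOf)) (List.length-applyUpTo diagonalHeight (d C)) ⟨
      fRaw (length profileOf) (coinsOf profileOf)
        ≡⟨ fRaw-coinsOf profileOf-profile ⟩
      polyominoOf profileOf
        ∎
      where open ≡-Reasoning

  weight : List Coin → ℤ
  weight [] = 0ℤ
  weight ((_ , j) ∷ xs) = rowWeight j ℤ.+ weight xs

  rowParity? : ∀ r (x : Coin) → Dec (proj₂ x % 2 ≡ r)
  rowParity? r x = proj₂ x % 2 ℕ.≟ r

  rowParityCount : ℕ → List Coin → ℕ
  rowParityCount r xs = length (filter (rowParity? r) xs)

  rowWeight-parity : ∀ j → (j % 2 ≡ 0 × rowWeight j ≡ + 2) ⊎ (j % 2 ≡ 1 × rowWeight j ≡ ℤ.-1ℤ)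
  rowWeight-parity zero = inj₁ (refl , refl)
  rowWeight-parity (suc zero) = inj₂ (refl , refl)
  rowWeight-parity (suc (suc j)) = rowWeight-parity j

  weight-rowParityCount : ∀ xs → + (2 * rowParityCount 0 xs) - + rowParityCount 1 xs ≡ weight xs
  weight-rowParityCount [] = refl
  weight-rowParityCount ((a , j) ∷ xs) with rowWeight-parity j
  ... | inj₁ (even , w)
    rewrite List.filter-accept (rowParity? 0) {a , j} {xs} even
          | List.filter-reject (rowParity? 1) {a , j} {xs} (ℕ.0≢1+n ∘ trans (sym even)) = begin
    + (2 * suc e) - + o           ≡⟨ cong (λ n → + n - + o) (ℕ.*-suc 2 e) ⟩
    + 2 ℤ.+ + (2 * e) - + o       ≡⟨ regroup (+ (2 * e)) (+ o) ⟩
    + 2 ℤ.+ (+ (2 * e) - + o)     ≡⟨ cong₂ ℤ._+_ (sym w) (weight-rowParityCount xs) ⟩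
    rowWeight j ℤ.+ weight xs     ∎
    where
    open ≡-Reasoning
    e = rowParityCount 0 xs
    o = rowParityCount 1 xs
    regroup : ∀ x y → + 2 ℤ.+ x - y ≡ + 2 ℤ.+ (x - y)
    regroup = ℤSolver.solve-∀
  ... | inj₂ (odd , w)
    rewrite List.filter-reject (rowParity? 0) {a , j} {xs} (ℕ.1+n≢0 ∘ trans (sym odd))
          | List.filter-accept (rowParity? 1) {a , j} {xs} odd = begin
    + (2 * e) - (1ℤ ℤ.+ + o)      ≡⟨ regroup (+ (2 * e)) (+ o) ⟩
    ℤ.-1ℤ ℤ.+ (+ (2 * e) - + o)   ≡⟨ cong₂ ℤ._+_ (sym w) (weight-rowParityCount xs) ⟩
    rowWeight j ℤ.+ weight xs     ∎
    where
    open ≡-Reasoning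
    e = rowParityCount 0 xs
    o = rowParityCount 1 xs
    regroup : ∀ x y → x - (1ℤ ℤ.+ y) ≡ ℤ.-1ℤ ℤ.+ (x - y)
    regroup = ℤSolver.solve-∀

  weight-++ : ∀ xs ys → weight (xs ++ ys) ≡ weight xs ℤ.+ weight ys
  weight-++ [] ys = sym (ℤ.+-identityˡ (weight ys))
  weight-++ ((_ , j) ∷ xs) ys =
    trans (cong (λ w → rowWeight j ℤ.+ w) (weight-++ xs ys)) (sym (ℤ.+-assoc (rowWeight j) _ _))

  weight-nextDiagonal : ∀ xs → weight (map nextDiagonal xs) ≡ weight xs
  weight-nextDiagonal [] = refl
  weight-nextDiagonal ((_ , j) ∷ xs) = cong (λ w → rowWeight j ℤ.+ w) (weight-nextDiagonal xs)

  weight-firstDiagonal : ∀ k → weight (firstDiagonal k) ≡ diagonalWeight k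
  weight-firstDiagonal zero = refl
  weight-firstDiagonal (suc k) = cong (λ w → rowWeight k ℤ.+ w) (weight-firstDiagonal k)

  weight-coinsOf : ∀ ks → weight (coinsOf ks) ≡ profileWeight ks
  weight-coinsOf [] = refl
  weight-coinsOf (k ∷ ks) = begin
    weight (firstDiagonal k ++ map nextDiagonal (coinsOf ks))
      ≡⟨ weight-++ (firstDiagonal k) _ ⟩
    weight (firstDiagonal k) ℤ.+ weight (map nextDiagonal (coinsOf ks))
      ≡⟨ cong₂ ℤ._+_ (weight-firstDiagonal k) (trans (weight-nextDiagonal (coinsOf ks)) (weight-coinsOf ks)) ⟩
    diagonalWeight k ℤ.+ profileWeight ks
      ∎
    where open ≡-Reasoning

  row0-coin : ∀ C {i} → i < d C → (+ (2 * i) , 0) ∈ coins C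
  row0-coin C {i} i<d = Equivalence.from (row0 C _) (i , i<d , refl)

  row0-bound : ∀ C {i} → (+ (2 * i) , 0) ∈ coins C → i < d C
  row0-bound C {i} m with i′ , i′<d , 2i≡2i′ ← Equivalence.to (row0 C _) m =
    subst (_< d C) (sym (ℕ.*-cancelˡ-≡ i i′ 2 (ℤ.+-injective 2i≡2i′))) i′<d

  d-cong : ∀ C₁ C₂ → SameCoins C₁ C₂ → d C₁ ≡ d C₂
  d-cong C₁ C₂ same = ℕ.≤-antisym (d-mono C₁ C₂ (Equivalence.to (same _)))
                                  (d-mono C₂ C₁ (Equivalence.from (same _)))
    where
    d-mono : ∀ C₁ C₂ → coins C₁ ⊆ coins C₂ → d C₁ ≤ d C₂
    d-mono C₁ C₂ ⊆ = ℕ.≮⇒≥ λ d₂<d₁ → ℕ.<-irrefl refl (row0-bound C₂ (⊆ (row0-coin C₁ d₂<d₁)))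

  f-respects-SameCoins : (C₁ C₂ : CoinFountain) → SameCoins C₁ C₂ → f C₁ ≈T f C₂
  f-respects-SameCoins C₁ C₂ same = translate⇒≈T (trans (translate-identity (f C₁)) (begin
    fRaw (d C₁) (coins C₁)  ≡⟨ fRaw-cong (d C₁) (unique C₁) (unique C₂) (same _) ⟩
    fRaw (d C₁) (coins C₂)  ≡⟨ cong (λ n → fRaw n (coins C₂)) (d-cong C₁ C₂ same) ⟩
    fRaw (d C₂) (coins C₂)  ∎))
    where open ≡-Reasoning

  f-stanley : (C : CoinFountain) → IsStanley (f C) × (+ 2 ℤ.≤ columns (f C))
  f-stanley C = subst (λ P → IsStanley P × (+ 2 ℤ.≤ columns P)) (sym (f-profileOf C))
    (polyominoOf-stanley p ,
     subst (+ 2 ℤ.≤_) (sym (polyominoOf-columns p)) (ℤ.+≤+ (s≤s (profile-nonempty p))))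
    where
    p = profileOf-profile C

  f-injective : (C₁ C₂ : CoinFountain) → f C₁ ≈T f C₂ → SameCoins C₁ C₂
  f-injective C₁ C₂ f₁≈f₂ x with t , eq ← ≈T⇒translate f₁≈f₂ =
    ⇔.trans (∈-profileOf C₁) (subst (λ ks → x ∈ coinsOf ks ⇔ x ∈ coins C₂) (sym profile≡) (⇔.sym (∈-profileOf C₂)))
    where
    profile≡ : profileOf C₁ ≡ profileOf C₂
    profile≡ = polyominoOf-injective (profileOf-profile C₁) (profileOf-profile C₂)
      (subst₂ (λ P Q → translate _ P ≡ Q) (f-profileOf C₁) (f-profileOf C₂) eq)

  f-surjective : (P : Rows) → IsStanley P → + 2 ℤ.≤ columns P → ∃[ C ] (f C ≈T P)
  f-surjective P st two≤cols with n , cols ← ≤⇒offset two≤cols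
    with k , ks , p , t , eq ← polyominoOf-surjective n P st cols =
    fountainOf p , translate⇒≈T (subst (λ Q → translate t Q ≡ P) (sym (f-fountainOf p)) eq)

  f-columns : (C : CoinFountain) → columns (f C) ≡ + (d C + 1)
  f-columns C = begin
    columns (f C)                        ≡⟨ cong columns (f-profileOf C) ⟩
    columns (polyominoOf (profileOf C))  ≡⟨ polyominoOf-columns (profileOf-profile C) ⟩
    + suc (length (profileOf C))         ≡⟨ cong (λ n → + suc n) (List.length-applyUpTo _ (d C)) ⟩
    + suc (d C)                          ≡⟨ cong +_ (ℕ.+-comm 1 (d C)) ⟩
    + (d C + 1)                          ∎
    where open ≡-Reasoning

  f-area : (C : CoinFountain) → + (2 * eC C) - + oC C ≡ area (f C)
  f-area C = begin
    + (2 * eC C) - + oC C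
      ≡⟨ cong₂ (λ e o → + (2 * e) - + o) (count 0) (count 1) ⟩
    + (2 * rowParityCount 0 (coinsOf ks)) - + rowParityCount 1 (coinsOf ks)
      ≡⟨ weight-rowParityCount (coinsOf ks) ⟩
    weight (coinsOf ks)
      ≡⟨ weight-coinsOf ks ⟩
    profileWeight ks
      ≡⟨ polyominoOf-area (profileOf-profile C) ⟨
    area (polyominoOf ks)
      ≡⟨ cong area (f-profileOf C) ⟨
    area (f C) ∎
    where
    open ≡-Reasoning
    ks = profileOf C
    count : ∀ r → rowParityCount r (coins C) ≡ rowParityCount r (coinsOf ks)
    count r = count-cong (rowParity? r) (unique C) (coinsOf-unique ks) (∈-profileOf C)

open import Data.Nat using (ℕ; _+_; _*_)
open import Data.Integer using (ℤ; +_; _-_; _≤_)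
open import Data.Product using (_×_; _,_; ∃-syntax)
open import Relation.Binary.PropositionalEquality using (_≡_)
open Fountains using (f-respects-SameCoins; f-stanley; f-injective; f-surjective; f-columns; f-area)

theorem2p12 :
    ((C₁ C₂ : CoinFountain) → SameCoins C₁ C₂ → f C₁ ≈T f C₂)
    × ((C : CoinFountain) → IsStanley (f C) × (+ 2 ≤ columns (f C)))
    × ((C₁ C₂ : CoinFountain) → f C₁ ≈T f C₂ → SameCoins C₁ C₂)
    × ((P : Rows) → IsStanley P → + 2 ≤ columns P → ∃[ C ] (f C ≈T P))
    × ((C : CoinFountain) →
         (columns (f C) ≡ + (d C + 1))
         × ((+ (2 * eC C)) - (+ oC C) ≡ area (f C)))
theorem2p12 = f-respects-SameCoins , f-stanley , f-injective , f-surjective , λ C → f-columns C , f-area C
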